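{- Let $\ell > 3$ be an odd integer. Suppose $n = 2\ell + \alpha$, where $\alpha > 0$ and $\alpha = \beta(\ell+1) + \gamma(3\ell+1)$ for some nonnegative integers $\beta,\gamma$. Then the honeycomb toroidal graph $\mathrm{HTG}(1,n,\ell)$ is 2-spanning cyclable.
   Context: For integers $m\ge 1$, $\ell\ge 0$ and $n\ge 4$ with $n$ even and $m-\ell$ even, the honeycomb toroidal graph $\mathrm{HTG}(m,n,\ell)$ is the simple graph with vertex set $\{u_{i,j}: 0\le i\le m-1,\ 0\le j\le n-1\}$ (first subscript computed modulo $m$, second modulo $n$) whose edge set is the set of the following unordered pairs: $\{u_{i,j},u_{i,j+1}\}$ for all $i,j$ (vertical edges); $\{u_{i,j},u_{i+1,j}\}$ for all $0\le i\le m-2$ with $i+j$ odd (flat edges); and $\{u_{m-1,j},u_{0,j+\ell}\}$ for all $j$ having the same parity as $m$ (and $\ell$) (jump edges). In particular, for $m=1$ the graph has vertices $u_{0,0},\dots,u_{0,n-1}$, the cycle edges $\{u_{0,j},u_{0,j+1}\}$, and the edges $\{u_{0,j},u_{0,j+\ell}\}$ for odd $j$. A 2-factor of a graph is a spanning subgraph in which every vertex has valency 2. A graph $X$ is 2-spanning cyclable if for every pair of distinct vertices $u,v$ of $X$ there is a 2-factor of $X$ consisting of exactly two cycles such that $u$ and $v$ lie in different cycles. -}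

module Defs where

open import Data.Nat using (ℕ; suc; _+_; _*_; _∸_; _%_; _≤_; _<_)
open import Data.Fin using (Fin; toℕ)
open import Data.Product using (_×_; _,_; ∃)
open import Data.Sum using (_⊎_)
open import Data.List using (List; []; _∷_; length; _∷ʳ_)
open import Data.List.Relation.Unary.Linked using (Linked)
open import Data.List.Relation.Unary.Unique.Propositional using (Unique)
open import Data.List.Membership.Propositional using (_∈_)
open import Relation.Binary.PropositionalEquality using (_≡_; _≢_)
open import Data.Empty using (⊥)
open import Relation.Nullary using (¬_)

record Graph : Set₁ where
  field
    V   : Set
    Adj : V → V → Set

HVertex : ℕ → ℕ → Set
HVertex m n = Fin m × Fin n

-- b ≡ (a + k) mod n, expressed without division: a + k = b + q n for some q
-- (b < n holds since b = toℕ of a Fin n).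
ShiftMod : (n a k b : ℕ) → Set
ShiftMod n a k b = ∃ λ q → a + k ≡ b + q * n

data HEdge (m n ℓ : ℕ) : HVertex m n → HVertex m n → Set where
  vertical : ∀ {i j j'} → ShiftMod n (toℕ j) 1 (toℕ j') →
             HEdge m n ℓ (i , j) (i , j')
  flat     : ∀ {i i' j} → suc (toℕ i) < suc m → toℕ i' ≡ suc (toℕ i) →
             (toℕ i + toℕ j) % 2 ≡ 1 →
             HEdge m n ℓ (i , j) (i' , j)
  jump     : ∀ {i i' j j'} → toℕ i ≡ m ∸ 1 → toℕ i' ≡ 0 →
             toℕ j % 2 ≡ m % 2 → ShiftMod n (toℕ j) ℓ (toℕ j') →
             HEdge m n ℓ (i , j) (i' , j')

HTG : ℕ → ℕ → ℕ → Graph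
HTG m n ℓ = record
  { V   = HVertex m n
  ; Adj = λ x y → x ≢ y × (HEdge m n ℓ x y ⊎ HEdge m n ℓ y x)
  }

-- A cycle of X given as the cyclic sequence of its distinct vertices
-- x ∷ xs (at least 3 vertices), consecutive ones adjacent, last adjacent to x.
IsCycle : (X : Graph) → List (Graph.V X) → Set
IsCycle X []       = ⊥
IsCycle X (x ∷ xs) =
  2 ≤ length xs × Unique (x ∷ xs) × Linked (Graph.Adj X) ((x ∷ xs) ∷ʳ x)

TwoCycleFactor : (X : Graph) → List (Graph.V X) → List (Graph.V X) → Set
TwoCycleFactor X C₁ C₂ =
  IsCycle X C₁ × IsCycle X C₂ ×
  (∀ v → v ∈ C₁ ⊎ v ∈ C₂) × (∀ v → v ∈ C₁ → ¬ (v ∈ C₂))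

TwoSpanningCyclable : Graph → Set
TwoSpanningCyclable X =
  ∀ (u v : Graph.V X) → u ≢ v →
  ∃ λ C₁ → ∃ λ C₂ → TwoCycleFactor X C₁ C₂ × u ∈ C₁ × v ∈ C₂

-- Write L = ℓ = 5 + 2q and N = 2L + α = 2L + β(L + 1) + γ(3L + 1), and address the vertex
-- u_{0, t mod N} by any natural t.  For odd b the vertices b + o with o ∈ [2, L) ∪ [L + 2, 2L)
-- form a cycle C₁: two vertical runs joined by the chords b + 2 ~ b + L + 2 and
-- b + L - 1 ~ b + 2L - 1.  The remaining vertices lie on a single cycle C₂ made of paths
-- through consecutive segments ([b, b + 2L) minus C₁, then β segments of length L + 1 and
-- γ of length 3L + 1), each path running from the second vertex of its segment to an odd
-- vertex whose chord enters the second vertex of the next segment.  Given u ≠ v, a case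
-- analysis on the parity of u and the distance from u to v, using N ≥ 3L + 1 (that is,
-- α > 0), yields an odd b with u ∈ C₁ and v ∉ C₁.
module Submission where

open import Defs
open import Data.Nat using (ℕ; zero; suc; _+_; _*_; _∸_; _%_; _/_; _≤_; _<_; _≤ᵇ_; z≤n; s≤s; s≤s⁻¹;
  NonZero; >-nonZero; _≤?_; _<?_)
open import Data.Nat.Properties
open import Data.Nat.DivMod
open import Data.Nat.Divisibility using (m%n≡0⇒n∣m)
open import Data.Nat.ListAction using (sum)
open import Data.Nat.Tactic.RingSolver using (solve-∀)
open import Data.Empty using (⊥; ⊥-elim)
open import Data.Unit using (⊤; tt)
open import Data.Bool using (T)
open import Data.Product using (∃; _×_; _,_; proj₁; proj₂; uncurry)
open import Data.Sum using (_⊎_; inj₁; inj₂; [_,_]′)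
open import Data.Fin as Fin using (Fin; toℕ)
open import Data.Fin.Properties using (toℕ-fromℕ<; toℕ-injective; toℕ<n)
open import Function using (_∘_)
open import Relation.Nullary using (¬_; yes; no)
open import Relation.Binary.PropositionalEquality
  using (_≡_; _≢_; refl; sym; trans; cong; cong₂; subst; subst₂; setoid; module ≡-Reasoning)
open import Data.List using (List; []; _∷_; _++_; map; length; applyUpTo; applyDownFrom; concatMap)
open import Data.List.Properties
  using (applyUpTo-∷ʳ; map-applyUpTo; map-++; length-map; length-++; length-applyUpTo; length-applyDownFrom)
import Data.List.Relation.Unary.All as All
import Data.List.Relation.Unary.All.Properties as All
open import Data.List.Relation.Unary.Any using (here; there)
open import Data.List.Relation.Unary.AllPairs using ([]; _∷_)
open import Data.List.Relation.Unary.Unique.Propositional using (Unique)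
import Data.List.Relation.Unary.Unique.Propositional.Properties as Unique
open import Data.List.Relation.Unary.Linked using (Linked; [-]; _∷_)
open import Data.List.Membership.Propositional using (_∈_)
open import Data.List.Membership.Propositional.Properties
  using (∈-++⁻; ∈-++⁺ˡ; ∈-++⁺ʳ; ∈-map⁺; ∈-map⁻; ∈-applyUpTo⁺; ∈-applyUpTo⁻; ∈-applyDownFrom⁺; ∈-applyDownFrom⁻)
open import Data.List.Relation.Binary.Permutation.Propositional
  using (_↭_; ↭-refl; ↭-prep; ↭-swap; ↭-sym; ↭-trans; ↭-reflexive; ↭⇒↭ₛ)
import Data.List.Relation.Binary.Permutation.Propositional.Properties as ↭
import Data.List.Relation.Binary.Permutation.Setoid.Properties as ↭ₛ
import Algebra.Solver.CommutativeMonoid (↭.++-commutativeMonoid {A = ℕ}) as CM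
open CM using (_⊜_; _⊕_; id)

private
  variable
    A B : Set

Even Odd : ℕ → Set
Even n = n % 2 ≡ 0
Odd  n = n % 2 ≡ 1

%2-distrib-+ : ∀ {m n a c} → m % 2 ≡ a → n % 2 ≡ c → (m + n) % 2 ≡ (a + c) % 2
%2-distrib-+ {m} {n} refl refl = %-distribˡ-+ m n 2

even+even : ∀ {m n} → Even m → Even n → Even (m + n)
even+even {m} {n} = %2-distrib-+ {m} {n}

even+odd : ∀ {m n} → Even m → Odd n → Odd (m + n)
even+odd {m} {n} = %2-distrib-+ {m} {n}

odd+even : ∀ {m n} → Odd m → Even n → Odd (m + n)
odd+even {m} {n} = %2-distrib-+ {m} {n}

even⊎odd : ∀ n → Even n ⊎ Odd n
even⊎odd n with n % 2 | m%n<n n 2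
... | 0     | _               = inj₁ refl
... | 1     | _               = inj₂ refl
... | suc (suc _) | s≤s (s≤s ())

even-*ˡ : ∀ m n → Even m → Even (m * n)
even-*ˡ m n e = trans (%-distribˡ-* m n 2) (cong (λ r → (r * (n % 2)) % 2) e)

even-*ʳ : ∀ m {n} → Even n → Even (m * n)
even-*ʳ m {n} e = trans (cong (_% 2) (*-comm m n)) (even-*ˡ n m e)

data Walk (R : A → A → Set) : A → List A → A → Set where
  []  : ∀ {x} → Walk R x [] x
  _∷_ : ∀ {x y l z} → R x y → Walk R y l z → Walk R x (y ∷ l) z

module _ {R : A → A → Set} where

  _++ʷ_ : ∀ {x l y l′ z} → Walk R x l y → Walk R y l′ z → Walk R x (l ++ l′) z
  []      ++ʷ w′ = w′
  (e ∷ w) ++ʷ w′ = e ∷ (w ++ʷ w′)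

  Walk⇒Linked : ∀ {x l y} → Walk R x l y → Linked R (x ∷ l)
  Walk⇒Linked []            = [-]
  Walk⇒Linked (e ∷ [])      = e ∷ [-]
  Walk⇒Linked (e ∷ w@(_ ∷ _)) = e ∷ Walk⇒Linked w

  applyUpTo-Walk : ∀ (f : ℕ → A) → (∀ i → R (f i) (f (suc i))) →
                   ∀ n → Walk R (f 0) (applyUpTo (f ∘ suc) n) (f n)
  applyUpTo-Walk f step zero    = []
  applyUpTo-Walk f step (suc n) = step 0 ∷ applyUpTo-Walk (f ∘ suc) (step ∘ suc) n

  applyDownFrom-Walk : ∀ (f : ℕ → A) → (∀ i → R (f (suc i)) (f i)) →
                       ∀ n → Walk R (f n) (applyDownFrom f n) (f 0)
  applyDownFrom-Walk f step zero    = []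
  applyDownFrom-Walk f step (suc n) = step n ∷ applyDownFrom-Walk f step n

map-Walk : ∀ {R : A → A → Set} {S : B → B → Set} (f : A → B) →
           (∀ {x y} → R x y → S (f x) (f y)) →
           ∀ {x l y} → Walk R x l y → Walk S (f x) (map f l) (f y)
map-Walk f hom []      = []
map-Walk f hom (e ∷ w) = hom e ∷ map-Walk f hom w

Unique-resp-↭ : ∀ {xs ys : List A} → xs ↭ ys → Unique xs → Unique ys
Unique-resp-↭ {A = A} p = ↭ₛ.Unique-resp-↭ (setoid A) (↭⇒↭ₛ p)

Unique-++⁻ˡ : ∀ (xs : List A) {ys} → Unique (xs ++ ys) → Unique xs
Unique-++⁻ˡ []       u       = []
Unique-++⁻ˡ (x ∷ xs) (a ∷ u) = All.++⁻ˡ xs a ∷ Unique-++⁻ˡ xs u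

Unique-++⁻ʳ : ∀ (xs : List A) {ys} → Unique (xs ++ ys) → Unique ys
Unique-++⁻ʳ []       u       = u
Unique-++⁻ʳ (x ∷ xs) (_ ∷ u) = Unique-++⁻ʳ xs u

Unique-++⇒disjoint : ∀ (xs : List A) {ys v} → Unique (xs ++ ys) → v ∈ xs → v ∈ ys → ⊥
Unique-++⇒disjoint (x ∷ xs) (a ∷ u) (here refl) v∈ys = All.lookup (All.++⁻ʳ xs a) v∈ys refl
Unique-++⇒disjoint (x ∷ xs) (a ∷ u) (there v∈xs) v∈ys = Unique-++⇒disjoint xs u v∈xs v∈ys

module _ (X : Graph) where
  open Graph X

  closedWalk⇒IsCycle : ∀ {x l y} → Walk Adj x l y → Adj y x → 2 ≤ length l →
                       Unique (x ∷ l) → IsCycle X (x ∷ l)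
  closedWalk⇒IsCycle w e long u = long , u , Walk⇒Linked (w ++ʷ (e ∷ []))

  partition⇒TwoCycleFactor : ∀ {C₁ C₂} → (Unique C₁ → IsCycle X C₁) → (Unique C₂ → IsCycle X C₂) →
                             Unique (C₁ ++ C₂) → (∀ v → v ∈ C₁ ++ C₂) → TwoCycleFactor X C₁ C₂
  partition⇒TwoCycleFactor {C₁} cyc₁ cyc₂ u cover =
    cyc₁ (Unique-++⁻ˡ C₁ u) , cyc₂ (Unique-++⁻ʳ C₁ u) ,
    (λ v → ∈-++⁻ C₁ (cover v)) , (λ v → Unique-++⇒disjoint C₁ u)

m+k≡n⇒m≤n : ∀ {m n} k → m + k ≡ n → m ≤ n
m+k≡n⇒m≤n {m} k refl = m≤m+n m k

m∸n+[n+o]≡m+o : ∀ {m n o} → n ≤ m → m ∸ n + (n + o) ≡ m + o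
m∸n+[n+o]≡m+o {m} {n} {o} n≤m = trans (sym (+-assoc (m ∸ n) n o)) (cong (_+ o) (m∸n+n≡m n≤m))

≤-complement : ∀ {a c d e n} → d + e ≡ n → e ≤ c → a + c ≤ n → a ≤ d
≤-complement {a} {c} {d} d+e≡n e≤c a+c≤n =
  +-cancelʳ-≤ c a d (≤-trans a+c≤n (≤-trans (≤-reflexive (sym d+e≡n)) (+-monoʳ-≤ d e≤c)))

m+[n+o]≡n+m+o : ∀ i a b → i + (a + b) ≡ a + i + b
m+[n+o]≡n+m+o i a b = trans (sym (+-assoc i a b)) (cong (_+ b) (+-comm i a))

applyUpTo-cong : ∀ {f g : ℕ → A} → (∀ i → f i ≡ g i) → ∀ n → applyUpTo f n ≡ applyUpTo g n
applyUpTo-cong f≗g zero    = refl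
applyUpTo-cong f≗g (suc n) = cong₂ _∷_ (f≗g 0) (applyUpTo-cong (f≗g ∘ suc) n)

applyUpTo-++ : ∀ (f : ℕ → A) m k → applyUpTo f (m + k) ≡ applyUpTo f m ++ applyUpTo (f ∘ (m +_)) k
applyUpTo-++ f zero    k = refl
applyUpTo-++ f (suc m) k = cong (f 0 ∷_) (applyUpTo-++ (f ∘ suc) m k)

applyDownFrom↭applyUpTo : ∀ (f : ℕ → A) n → applyDownFrom f n ↭ applyUpTo f n
applyDownFrom↭applyUpTo f zero    = ↭-refl
applyDownFrom↭applyUpTo f (suc n) =
  ↭-trans (↭-prep (f n) (applyDownFrom↭applyUpTo f n))
  (↭-trans (↭.∷↭∷ʳ (f n) (applyUpTo f n)) (↭-reflexive (applyUpTo-∷ʳ f n)))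

up down : ℕ → ℕ → List ℕ
up   a m = applyUpTo     (_+ a) m
down a m = applyDownFrom (_+ a) m

up-++ : ∀ a m k → up a m ++ up (m + a) k ≡ up a (m + k)
up-++ a m k = sym (trans (applyUpTo-++ (_+ a) m k) (cong (up a m ++_) (applyUpTo-cong shift k)))
  where
    shift : ∀ i → (m + i) + a ≡ i + (m + a)
    shift i = trans (cong (_+ a) (+-comm m i)) (+-assoc i m a)

down↭up : ∀ a m → down a m ↭ up a m
down↭up a = applyDownFrom↭applyUpTo (_+ a)

Consecutive : ℕ → List (ℕ × ℕ) → Set
Consecutive a []              = ⊤
Consecutive a ((a′ , m) ∷ rs) = a′ ≡ a × Consecutive (m + a′) rs

consecutive-runs : ∀ {a} rs → Consecutive a rs → concatMap (uncurry up) rs ≡ up a (sum (map proj₂ rs))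
consecutive-runs {a} []              _            = refl
consecutive-runs {a} ((a′ , m) ∷ rs) (refl , cs) =
  trans (cong (up a m ++_) (consecutive-runs rs cs)) (up-++ a m (sum (map proj₂ rs)))

module Residues (N : ℕ) {{_ : NonZero N}} where

  vtx : ℕ → Fin 1 × Fin N
  vtx t = (Fin.zero , t mod N)

  toℕ-vtx : ∀ t → toℕ (proj₂ (vtx t)) ≡ t % N
  toℕ-vtx t = toℕ-fromℕ< (m%n<n t N)

  vtx-≡⇒%-≡ : ∀ {s t} → vtx s ≡ vtx t → s % N ≡ t % N
  vtx-≡⇒%-≡ {s} {t} e = trans (sym (toℕ-vtx s)) (trans (cong (toℕ ∘ proj₂) e) (toℕ-vtx t))

  %-≡⇒vtx-≡ : ∀ {s t} → s % N ≡ t % N → vtx s ≡ vtx t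
  %-≡⇒vtx-≡ {s} {t} e = cong (Fin.zero ,_) (toℕ-injective (trans (toℕ-vtx s) (trans e (sym (toℕ-vtx t)))))

  vtx-+N : ∀ t → vtx (t + N) ≡ vtx t
  vtx-+N t = %-≡⇒vtx-≡ ([m+n]%n≡m%n t N)

  vtx-toℕ : ∀ (y : Fin N) → vtx (toℕ y) ≡ (Fin.zero , y)
  vtx-toℕ y = cong (Fin.zero ,_) (toℕ-injective (trans (toℕ-vtx (toℕ y)) (m<n⇒m%n≡m (toℕ<n y))))

  %-congʳ-+ : ∀ {m n} c → m % N ≡ n % N → (m + c) % N ≡ (n + c) % N
  %-congʳ-+ {m} {n} c e = begin
    (m + c) % N           ≡⟨ %-distribˡ-+ m c N ⟩
    (m % N + c % N) % N   ≡⟨ cong (λ r → (r + c % N) % N) e ⟩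
    (n % N + c % N) % N   ≡⟨ %-distribˡ-+ n c N ⟨
    (n + c) % N           ∎
    where open ≡-Reasoning

  +-absorbs-% : ∀ m {c} → c % N ≡ 0 → (m + c) % N ≡ m % N
  +-absorbs-% m {c} c≡0 = begin
    (m + c) % N          ≡⟨ %-distribˡ-+ m c N ⟩
    (m % N + c % N) % N  ≡⟨ cong (λ r → (m % N + r) % N) c≡0 ⟩
    (m % N + 0) % N      ≡⟨ cong (_% N) (+-identityʳ (m % N)) ⟩
    m % N % N            ≡⟨ m%n%n≡m%n m N ⟩
    m % N                ∎
    where open ≡-Reasoning

  [N∸a%N+a]%N≡0 : ∀ a → (N ∸ a % N + a) % N ≡ 0
  [N∸a%N+a]%N≡0 a = begin
    (N ∸ a % N + a) % N                  ≡⟨ cong (λ t → (N ∸ a % N + t) % N) (m≡m%n+[m/n]*n a N) ⟩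
    (N ∸ a % N + (a % N + a / N * N)) % N ≡⟨ cong (_% N) (+-assoc (N ∸ a % N) (a % N) (a / N * N)) ⟨
    (N ∸ a % N + a % N + a / N * N) % N   ≡⟨ cong (λ t → (t + a / N * N) % N) (m∸n+n≡m (<⇒≤ (m%n<n a N))) ⟩
    (N + a / N * N) % N                   ≡⟨ [m+kn]%n≡m%n N (a / N) N ⟩
    N % N                                 ≡⟨ n%n≡0 N ⟩
    0                                     ∎
    where open ≡-Reasoning

  %-cancelʳ-+ : ∀ a {m n} → (m + a) % N ≡ (n + a) % N → m % N ≡ n % N
  %-cancelʳ-+ a {m} {n} e = begin
    m % N                    ≡⟨ +-absorbs-% m ([N∸a%N+a]%N≡0 a) ⟨
    (m + (a⁻ + a)) % N       ≡⟨ cong (_% N) (regroup m) ⟩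
    (m + a + a⁻) % N         ≡⟨ %-congʳ-+ a⁻ e ⟩
    (n + a + a⁻) % N         ≡⟨ cong (_% N) (regroup n) ⟨
    (n + (a⁻ + a)) % N       ≡⟨ +-absorbs-% n ([N∸a%N+a]%N≡0 a) ⟩
    n % N                    ∎
    where
      open ≡-Reasoning
      a⁻ = N ∸ a % N
      regroup : ∀ x → x + (a⁻ + a) ≡ x + a + a⁻
      regroup x = trans (cong (x +_) (+-comm a⁻ a)) (sym (+-assoc x a a⁻))

  reach : ∀ a (y : Fin N) → ∃ λ i → i < N × vtx (i + a) ≡ (Fin.zero , y)
  reach a y = i , m%n<n _ N , trans (%-≡⇒vtx-≡ i+a≡y) (vtx-toℕ y)
    where
      open ≡-Reasoning
      a⁻ = N ∸ a % N
      i = (toℕ y + a⁻) % N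
      i+a≡y : (i + a) % N ≡ toℕ y % N
      i+a≡y = begin
        (i + a) % N              ≡⟨ %-congʳ-+ a (m%n%n≡m%n (toℕ y + a⁻) N) ⟩
        (toℕ y + a⁻ + a) % N     ≡⟨ cong (_% N) (+-assoc (toℕ y) a⁻ a) ⟩
        (toℕ y + (a⁻ + a)) % N   ≡⟨ +-absorbs-% (toℕ y) ([N∸a%N+a]%N≡0 a) ⟩
        toℕ y % N                ∎

  shiftMod : ∀ t k → ShiftMod N (t % N) k ((t + k) % N)
  shiftMod t k = (t % N + k) / N , trans (m≡m%n+[m/n]*n (t % N + k) N)
                                     (cong (_+ (t % N + k) / N * N) (%-congʳ-+ k (m%n%n≡m%n t N)))

  up-vtx-Unique : ∀ a → Unique (map vtx (up a N))
  up-vtx-Unique a = subst Unique (sym (map-applyUpTo (_+ a) vtx N))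
    (Unique.applyUpTo⁺₁ (vtx ∘ (_+ a)) N distinct)
    where
      distinct : ∀ {i j} → i < j → j < N → vtx (i + a) ≢ vtx (j + a)
      distinct {i} {j} i<j j<N e = <⇒≢ i<j (begin
        i      ≡⟨ m<n⇒m%n≡m (<-trans i<j j<N) ⟨
        i % N  ≡⟨ %-cancelʳ-+ a (vtx-≡⇒%-≡ e) ⟩
        j % N  ≡⟨ m<n⇒m%n≡m j<N ⟩
        j      ∎)
        where open ≡-Reasoning

  up-vtx-complete : ∀ a v → v ∈ map vtx (up a N)
  up-vtx-complete a (Fin.zero , y) with i , i<N , hit ← reach a y =
    subst (_∈ map vtx (up a N)) hit (∈-map⁺ vtx (∈-applyUpTo⁺ (_+ a) i<N))

-- L = 5 + 2q; the quantities 2L = 10 + 4q, L + 1 = 6 + 2q and 3L + 1 = 16 + 6q are spelled out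
-- in terms of q so that the ring solver can normalise them.
module HTG₁ (q N : ℕ) {{_ : NonZero N}} (N-even : Even N) (2L≤N : 10 + 4 * q ≤ N) where
  open Residues N

  L : ℕ
  L = 5 + 2 * q

  G : Graph
  G = HTG 1 N L

  E : ℕ → ℕ → Set
  E s t = Graph.Adj G (vtx s) (vtx t)

  E-sym : ∀ {s t} → E s t → E t s
  E-sym (s≢t , inj₁ st) = (λ e → s≢t (sym e)) , inj₂ st
  E-sym (s≢t , inj₂ ts) = (λ e → s≢t (sym e)) , inj₁ ts

  vtx-+-≢ : ∀ t {k} → 0 < k → k < N → vtx t ≢ vtx (t + k)
  vtx-+-≢ t {k} 0<k k<N e = <⇒≢ 0<k (begin
    0      ≡⟨ m<n⇒m%n≡m 0<k⇒0<N ⟨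
    0 % N  ≡⟨ %-cancelʳ-+ t (trans (vtx-≡⇒%-≡ e) (cong (_% N) (+-comm t k))) ⟩
    k % N  ≡⟨ m<n⇒m%n≡m k<N ⟩
    k      ∎)
    where
      open ≡-Reasoning
      0<k⇒0<N = <-trans 0<k k<N

  ≤-linear : ∀ a b c d → {T (a ≤ᵇ c)} → {T (b ≤ᵇ d)} → a + b * q ≤ c + d * q
  ≤-linear a b c d {a≤c} {b≤d} = +-mono-≤ (≤ᵇ⇒≤ a c a≤c) (*-monoˡ-≤ q (≤ᵇ⇒≤ b d b≤d))

  L<N : L < N
  L<N = ≤-trans (≤-linear 6 2 10 4) 2L≤N

  step : ∀ t → E t (suc t)
  step t = (λ e → vtx-+-≢ t (s≤s z≤n) (<-trans (s≤s (s≤s z≤n)) L<N) (trans e (cong vtx (+-comm 1 t)))) ,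
           inj₁ (vertical (subst₂ (λ a b → ShiftMod N a 1 b)
                  (sym (toℕ-vtx t)) (trans (cong (_% N) (+-comm t 1)) (sym (toℕ-vtx (suc t)))) (shiftMod t 1)))

  chord : ∀ t → Odd t → E t (t + L)
  chord t odd = vtx-+-≢ t (s≤s z≤n) L<N ,
                inj₁ (jump refl refl vtx-odd
                  (subst₂ (λ a b → ShiftMod N a L b) (sym (toℕ-vtx t)) (sym (toℕ-vtx (t + L))) (shiftMod t L)))
    where
      vtx-odd : toℕ (proj₂ (vtx t)) % 2 ≡ 1
      vtx-odd = trans (cong (_% 2) (toℕ-vtx t)) (trans (m∣n⇒o%n%m≡o%m 2 N t (m%n≡0⇒n∣m N 2 N-even)) odd)

  chord′ : ∀ {t t′} → Odd t → t + L ≡ t′ → E t t′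
  chord′ {t} odd refl = chord t odd

  chord⁻ : ∀ {t t′} → Odd t → t + L ≡ t′ → E t′ t
  chord⁻ odd eq = E-sym (chord′ odd eq)

  up-Walk : ∀ {p} a m → E p a → Walk E p (up a (suc m)) (m + a)
  up-Walk a m e = e ∷ applyUpTo-Walk (_+ a) (λ i → step (i + a)) m

  down-Walk : ∀ {p} a m → E p (m + a) → Walk E p (down a (suc m)) a
  down-Walk a m e = e ∷ applyDownFrom-Walk (_+ a) (λ i → E-sym (step (i + a))) m

  -- A path through the vertices of [s, s + m) outside the hole H, from s + 1 to an odd vertex
  -- whose chord leads to s + m + 1, where the path through the next strip begins.
  record Strip (s m : ℕ) (H : List ℕ) : Set where
    field
      tail      : List ℕ
      exit      : ℕ
      walk      : Walk E (suc s) tail exit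
      exit-odd  : Odd exit
      exit-jump : exit + L ≡ suc (m + s)
      tiling    : (suc s ∷ tail) ++ H ↭ up s m

  _⨾_ : ∀ {s m k H} → Strip s m H → Strip (m + s) k [] → Strip s (m + k) H
  _⨾_ {s} {m} {k} {H} S T = record
    { tail      = S.tail ++ (suc (m + s) ∷ T.tail)
    ; exit      = T.exit
    ; walk      = S.walk ++ʷ (chord′ S.exit-odd S.exit-jump ∷ T.walk)
    ; exit-odd  = T.exit-odd
    ; exit-jump = trans T.exit-jump (cong suc (sym ([m+k]+s≡k+[m+s] m k s)))
    ; tiling    = ↭-trans (reorder (suc s ∷ S.tail) (suc (m + s) ∷ T.tail) H)
                  (↭-trans (↭.++⁺ S.tiling T.tiling) (↭-reflexive (up-++ s m k)))
    }
    where
      module S = Strip S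
      module T = Strip T
      reorder : (P Q H : List ℕ) → (P ++ Q) ++ H ↭ (P ++ H) ++ (Q ++ [])
      reorder = CM.solve 3 (λ P Q H → (P ⊕ Q) ⊕ H ⊜ (P ⊕ H) ⊕ (Q ⊕ id)) ↭-refl
      [m+k]+s≡k+[m+s] : ∀ m k s → (m + k) + s ≡ k + (m + s)
      [m+k]+s≡k+[m+s] = solve-∀

  extend : ∀ {s m k H} → Odd s → Even m → Even k → (∀ t → Odd t → Strip t k []) →
           Strip s m H → ∀ n → Strip s (n * k + m) H
  extend _ _ _ _ S zero = S
  extend {s} {m} {k} {H} s-odd m-even k-even block S (suc n) =
    subst (λ l → Strip s l H) ([n*k+m]+k≡[1+n]*k+m n k m)
      (extend s-odd m-even k-even block S n ⨾ block (n * k + m + s) next-odd)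
    where
      next-odd : Odd (n * k + m + s)
      next-odd = even+odd {n * k + m} {s} (even+even {n * k} {m} (even-*ʳ n k-even) m-even) s-odd
      [n*k+m]+k≡[1+n]*k+m : ∀ n k m → n * k + m + k ≡ suc n * k + m
      [n*k+m]+k≡[1+n]*k+m = solve-∀

  blockA : ∀ s → Odd s → Strip s (6 + 2 * q) []
  blockA s s-odd = record
    { tail      = s ∷ down (2 + s) (4 + 2 * q)
    ; exit      = 2 + s
    ; walk      = E-sym (step s) ∷ down-Walk (2 + s) (3 + 2 * q) (chord′ s-odd (s+L≡[L-2]+[2+s] q s))
    ; exit-odd  = s-odd
    ; exit-jump = [2+s]+L≡1+[L+1+s] q s
    ; tiling    = ↭-trans (↭.++-identityʳ _)
                  (↭-trans (↭-swap (suc s) s (down↭up (2 + s) (4 + 2 * q))) (↭-reflexive (up-++ s 2 (4 + 2 * q))))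
    }
    where
      s+L≡[L-2]+[2+s] : ∀ q s → s + (5 + 2 * q) ≡ 3 + 2 * q + (2 + s)
      s+L≡[L-2]+[2+s] = solve-∀
      [2+s]+L≡1+[L+1+s] : ∀ q s → 2 + s + (5 + 2 * q) ≡ suc (6 + 2 * q + s)
      [2+s]+L≡1+[L+1+s] = solve-∀

  blockB : ∀ s → Odd s → Strip s (16 + 6 * q) []
  blockB s s-odd = record
    { tail      = s ∷ (P₂ ++ (P₃ ++ (P₄ ++ (P₅ ++ P₆))))
    ; exit      = 2 + (10 + 4 * q + s)
    ; walk      = E-sym (step s) ∷
                  (up-Walk (5 + 2 * q + s) 2 (chord′ s-odd (+-comm s L)) ++ʷ
                  (up-Walk (2 + s) (2 + 2 * q) (chord⁻ s-odd ([2+s]+L≡2+[L+s] q s)) ++ʷ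
                  (down-Walk (8 + 2 * q + s) (1 + 2 * q) (chord′ L-1+s-odd ([L-3]+[2+s]+L≡[L-4]+[L+3+s] q s)) ++ʷ
                  (up-Walk (13 + 4 * q + s) (2 + 2 * q) (chord′ L+3+s-odd ([L+3+s]+L≡2L+3+s q s)) ++ʷ
                  up-Walk (10 + 4 * q + s) 2 (chord⁻ exit-odd ([2L+s]+L≡[L-3]+[2L+3+s] q s))))))
    ; exit-odd  = exit-odd
    ; exit-jump = [2L+2+s]+L≡1+[3L+1+s] q s
    ; tiling    = ↭-trans (↭.++-identityʳ _)
                  (↭-trans (↭-swap (suc s) s (↭-trans (reorder P₂ P₃ P₄ P₅ P₆)
                    (↭.++⁺ˡ P₃ (↭.++⁺ˡ P₂ (↭.++⁺ʳ (P₆ ++ (P₅ ++ [])) (down↭up (8 + 2 * q + s) (2 + 2 * q)))))))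
                  (↭-reflexive (trans (consecutive-runs runs (refl , refl , L+s≡[L-2]+[2+s] q s , refl , 2L+s≡[L-3]+[L+3+s] q s , refl , tt))
                                      (cong (up s) (B-length q)))))
    }
    where
      P₂ = up (5 + 2 * q + s) 3
      P₃ = up (2 + s) (3 + 2 * q)
      P₄ = down (8 + 2 * q + s) (2 + 2 * q)
      P₅ = up (13 + 4 * q + s) (3 + 2 * q)
      P₆ = up (10 + 4 * q + s) 3
      runs : List (ℕ × ℕ)
      runs = (s , 2) ∷ (2 + s , 3 + 2 * q) ∷ (5 + 2 * q + s , 3) ∷ (8 + 2 * q + s , 2 + 2 * q) ∷
             (10 + 4 * q + s , 3) ∷ (13 + 4 * q + s , 3 + 2 * q) ∷ []
      L-1+s-odd : Odd (2 + 2 * q + (2 + s))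
      L-1+s-odd = even+odd {2 + 2 * q} {2 + s} (even-*ˡ 2 q refl) s-odd
      L+3+s-odd : Odd (8 + 2 * q + s)
      L+3+s-odd = even+odd {8 + 2 * q} {s} (even-*ˡ 2 q refl) s-odd
      exit-odd : Odd (10 + 4 * q + s)
      exit-odd = even+odd {4 * q} {s} (even-*ˡ 4 q refl) s-odd
      reorder : (P₂ P₃ P₄ P₅ P₆ : List ℕ) →
                P₂ ++ (P₃ ++ (P₄ ++ (P₅ ++ P₆))) ↭ P₃ ++ (P₂ ++ (P₄ ++ (P₆ ++ (P₅ ++ []))))
      reorder = CM.solve 5 (λ P₂ P₃ P₄ P₅ P₆ →
                  P₂ ⊕ (P₃ ⊕ (P₄ ⊕ (P₅ ⊕ P₆))) ⊜ P₃ ⊕ (P₂ ⊕ (P₄ ⊕ (P₆ ⊕ (P₅ ⊕ id))))) ↭-refl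
      [2+s]+L≡2+[L+s] : ∀ q s → 2 + s + (5 + 2 * q) ≡ 2 + (5 + 2 * q + s)
      [2+s]+L≡2+[L+s] = solve-∀
      [L-3]+[2+s]+L≡[L-4]+[L+3+s] : ∀ q s → 2 + 2 * q + (2 + s) + (5 + 2 * q) ≡ 1 + 2 * q + (8 + 2 * q + s)
      [L-3]+[2+s]+L≡[L-4]+[L+3+s] = solve-∀
      [L+3+s]+L≡2L+3+s : ∀ q s → 8 + 2 * q + s + (5 + 2 * q) ≡ 13 + 4 * q + s
      [L+3+s]+L≡2L+3+s = solve-∀
      [2L+s]+L≡[L-3]+[2L+3+s] : ∀ q s → 10 + 4 * q + s + (5 + 2 * q) ≡ 2 + 2 * q + (13 + 4 * q + s)
      [2L+s]+L≡[L-3]+[2L+3+s] = solve-∀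
      [2L+2+s]+L≡1+[3L+1+s] : ∀ q s → 2 + (10 + 4 * q + s) + (5 + 2 * q) ≡ suc (16 + 6 * q + s)
      [2L+2+s]+L≡1+[3L+1+s] = solve-∀
      L+s≡[L-2]+[2+s] : ∀ q s → 5 + 2 * q + s ≡ 3 + 2 * q + (2 + s)
      L+s≡[L-2]+[2+s] = solve-∀
      2L+s≡[L-3]+[L+3+s] : ∀ q s → 10 + 4 * q + s ≡ 2 + 2 * q + (8 + 2 * q + s)
      2L+s≡[L-3]+[L+3+s] = solve-∀
      B-length : ∀ q → 2 + (3 + 2 * q + (3 + (2 + 2 * q + (3 + (3 + 2 * q + 0))))) ≡ 16 + 6 * q
      B-length = solve-∀

  C₁ : ℕ → List ℕ
  C₁ b = up (2 + b) (3 + 2 * q) ++ down (7 + 2 * q + b) (3 + 2 * q)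

  C₁-walk : ∀ b → Odd b →
            Walk E (2 + b) (applyUpTo (λ i → suc i + (2 + b)) (2 + 2 * q) ++ down (7 + 2 * q + b) (3 + 2 * q)) (7 + 2 * q + b)
  C₁-walk b b-odd = applyUpTo-Walk (_+ (2 + b)) (λ i → step (i + (2 + b))) (2 + 2 * q) ++ʷ
                    down-Walk (7 + 2 * q + b) (2 + 2 * q) (chord′ L-1+b-odd ([L-3]+[2+b]+L≡[L-3]+[L+2+b] q b))
    where
      L-1+b-odd : Odd (2 + 2 * q + (2 + b))
      L-1+b-odd = even+odd {2 + 2 * q} {2 + b} (even-*ˡ 2 q refl) b-odd
      [L-3]+[2+b]+L≡[L-3]+[L+2+b] : ∀ q b → 2 + 2 * q + (2 + b) + (5 + 2 * q) ≡ 2 + 2 * q + (7 + 2 * q + b)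
      [L-3]+[2+b]+L≡[L-3]+[L+2+b] = solve-∀

  C₁-closing : ∀ b → Odd b → E (7 + 2 * q + b) (2 + b)
  C₁-closing b b-odd = chord⁻ b-odd ([2+b]+L≡L+2+b q b)
    where
      [2+b]+L≡L+2+b : ∀ q b → 2 + b + (5 + 2 * q) ≡ 7 + 2 * q + b
      [2+b]+L≡L+2+b = solve-∀

  C₁-strip : ∀ b → Odd b → Strip b (10 + 4 * q) (C₁ b)
  C₁-strip b b-odd = record
    { tail      = b ∷ U
    ; exit      = 6 + 2 * q + b
    ; walk      = E-sym (step b) ∷ up-Walk (5 + 2 * q + b) 1 (chord′ b-odd (+-comm b L))
    ; exit-odd  = even+odd {6 + 2 * q} {b} (even-*ˡ 2 q refl) b-odd
    ; exit-jump = [L+1+b]+L≡1+[2L+b] q b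
    ; tiling    = ↭-trans (↭-swap (suc b) b (↭-trans (reorder U P D)
                    (↭.++⁺ˡ P (↭.++⁺ˡ U (↭.++⁺ʳ [] (down↭up (7 + 2 * q + b) (3 + 2 * q)))))))
                  (↭-reflexive (trans (consecutive-runs runs (refl , refl , L+b≡[L-2]+[2+b] q b , refl , tt))
                                      (cong (up b) (2+[L-2]+2+[L-2]≡2L q))))
    }
    where
      U = up (5 + 2 * q + b) 2
      P = up (2 + b) (3 + 2 * q)
      D = down (7 + 2 * q + b) (3 + 2 * q)
      runs : List (ℕ × ℕ)
      runs = (b , 2) ∷ (2 + b , 3 + 2 * q) ∷ (5 + 2 * q + b , 2) ∷ (7 + 2 * q + b , 3 + 2 * q) ∷ []
      reorder : (U P D : List ℕ) → U ++ (P ++ D) ↭ P ++ (U ++ (D ++ []))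
      reorder = CM.solve 3 (λ U P D → U ⊕ (P ⊕ D) ⊜ P ⊕ (U ⊕ (D ⊕ id))) ↭-refl
      [L+1+b]+L≡1+[2L+b] : ∀ q b → 6 + 2 * q + b + (5 + 2 * q) ≡ suc (10 + 4 * q + b)
      [L+1+b]+L≡1+[2L+b] = solve-∀
      L+b≡[L-2]+[2+b] : ∀ q b → 5 + 2 * q + b ≡ 3 + 2 * q + (2 + b)
      L+b≡[L-2]+[2+b] = solve-∀
      2+[L-2]+2+[L-2]≡2L : ∀ q → 2 + (3 + 2 * q + (2 + (3 + 2 * q + 0))) ≡ 10 + 4 * q
      2+[L-2]+2+[L-2]≡2L = solve-∀

  C₁-length : ∀ b → length (C₁ b) ≡ 6 + 4 * q
  C₁-length b = begin
    length (C₁ b)                                                               ≡⟨ length-++ P ⟩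
    length P + length (down (7 + 2 * q + b) (3 + 2 * q))                         ≡⟨ cong₂ _+_
      (length-applyUpTo (_+ (2 + b)) (3 + 2 * q)) (length-applyDownFrom (_+ (7 + 2 * q + b)) (3 + 2 * q)) ⟩
    3 + 2 * q + (3 + 2 * q)                                                     ≡⟨ [L-2]+[L-2]≡2L-4 q ⟩
    6 + 4 * q                                                                   ∎
    where
      open ≡-Reasoning
      P = up (2 + b) (3 + 2 * q)
      [L-2]+[L-2]≡2L-4 : ∀ q → 3 + 2 * q + (3 + 2 * q) ≡ 6 + 4 * q
      [L-2]+[L-2]≡2L-4 = solve-∀

  tail-length : ∀ {s m H} (S : Strip s m H) → suc (length (Strip.tail S) + length H) ≡ m
  tail-length {s} {m} {H} S = begin
    suc (length tail + length H)    ≡⟨ cong suc (length-++ tail) ⟨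
    length ((suc s ∷ tail) ++ H)    ≡⟨ ↭.↭-length tiling ⟩
    length (up s m)                 ≡⟨ length-applyUpTo (_+ s) m ⟩
    m                               ∎
    where
      open ≡-Reasoning
      open Strip S

  closedStrip⇒TwoCycleFactor : ∀ b → Odd b → (S : Strip b N (C₁ b)) →
           TwoCycleFactor G (map vtx (C₁ b)) (map vtx (suc b ∷ Strip.tail S))
  closedStrip⇒TwoCycleFactor b b-odd S = partition⇒TwoCycleFactor G
    (closedWalk⇒IsCycle G (map-Walk vtx (λ e → e) (C₁-walk b b-odd)) (C₁-closing b b-odd) (s≤s (s≤s z≤n)))
    (closedWalk⇒IsCycle G (map-Walk vtx (λ e → e) walk) closing long)
    (Unique-resp-↭ (↭-sym vtx-perm) (up-vtx-Unique b))
    (λ v → ↭.∈-resp-↭ (↭-sym vtx-perm) (up-vtx-complete b v))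
    where
      open Strip S
      C₂ = suc b ∷ tail
      vtx-perm : map vtx (C₁ b) ++ map vtx C₂ ↭ map vtx (up b N)
      vtx-perm = subst (_↭ map vtx (up b N)) (map-++ vtx (C₁ b) C₂)
                   (↭.map⁺ vtx (↭-trans (↭.++-comm (C₁ b) C₂) tiling))
      closing : E exit (suc b)
      closing = subst (λ v → Graph.Adj G (vtx exit) v) (trans (cong (vtx ∘ suc) (+-comm N b)) (vtx-+N (suc b)))
                  (chord′ exit-odd exit-jump)
      long : 2 ≤ length (map vtx tail)
      long = subst (2 ≤_) (sym (length-map vtx tail)) (<⇒≤ (s≤s⁻¹ (+-cancelʳ-≤ (6 + 4 * q) 4 (suc (length tail)) (begin
        10 + 4 * q                          ≤⟨ 2L≤N ⟩
        N                                   ≡⟨ tail-length S ⟨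
        suc (length tail + length (C₁ b))   ≡⟨ cong (λ c → suc (length tail + c)) (C₁-length b) ⟩
        suc (length tail + (6 + 4 * q))     ∎))))
        where open ≤-Reasoning

  C₁-TwoCycleFactor : ∀ β γ → γ * (16 + 6 * q) + (β * (6 + 2 * q) + (10 + 4 * q)) ≡ N →
                   ∀ b → Odd b → ∃ λ C₂ → TwoCycleFactor G (map vtx (C₁ b)) C₂
  C₁-TwoCycleFactor β γ size b b-odd = _ , closedStrip⇒TwoCycleFactor b b-odd (subst (λ m → Strip b m (C₁ b)) size strip)
    where
      strip : Strip b (γ * (16 + 6 * q) + (β * (6 + 2 * q) + (10 + 4 * q))) (C₁ b)
      strip = extend b-odd (even+even {β * (6 + 2 * q)} {10 + 4 * q} (even-*ʳ β (even-*ˡ 2 q refl)) (even-*ˡ 4 q refl))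
                (even-*ˡ 6 q refl) blockB
                (extend b-odd (even-*ˡ 4 q refl) (even-*ˡ 2 q refl) blockA (C₁-strip b b-odd) β) γ

  InC₁ : ℕ → Set
  InC₁ o = (2 ≤ o × o < 5 + 2 * q) ⊎ (7 + 2 * q ≤ o × o < 10 + 4 * q)

  InC₁⇒<2L : ∀ {o} → InC₁ o → o < 10 + 4 * q
  InC₁⇒<2L (inj₁ (_ , o<L)) = <-≤-trans o<L (≤-linear 5 2 10 4)
  InC₁⇒<2L (inj₂ (_ , o<2L)) = o<2L

  ∈C₁⁺ : ∀ b {o} → InC₁ o → o + b ∈ C₁ b
  ∈C₁⁺ b {o} (inj₁ (2≤o , o<L)) =
    ∈-++⁺ˡ (subst (_∈ up (2 + b) (3 + 2 * q)) (m∸n+[n+o]≡m+o 2≤o) (∈-applyUpTo⁺ (_+ (2 + b)) (∸-monoˡ-< o<L 2≤o)))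
  ∈C₁⁺ b {o} (inj₂ (L+2≤o , o<2L)) =
    ∈-++⁺ʳ (up (2 + b) (3 + 2 * q))
      (subst (_∈ down (7 + 2 * q + b) (3 + 2 * q)) (m∸n+[n+o]≡m+o L+2≤o) (∈-applyDownFrom⁺ (_+ (7 + 2 * q + b)) i<))
    where
      2L≡[L-2]+[L+2] : ∀ q → 10 + 4 * q ≡ 3 + 2 * q + (7 + 2 * q)
      2L≡[L-2]+[L+2] = solve-∀
      i< : o ∸ (7 + 2 * q) < 3 + 2 * q
      i< = +-cancelʳ-< (7 + 2 * q) _ _ (subst₂ _<_ (sym (m∸n+n≡m L+2≤o)) (2L≡[L-2]+[L+2] q) o<2L)

  ∈C₁⁻ : ∀ b {t} → t ∈ C₁ b → ∃ λ o → InC₁ o × t ≡ o + b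
  ∈C₁⁻ b t∈ with ∈-++⁻ (up (2 + b) (3 + 2 * q)) t∈
  ... | inj₁ t∈P with i , i< , refl ← ∈-applyUpTo⁻ (_+ (2 + b)) t∈P =
    2 + i , inj₁ (m≤m+n 2 i , s≤s (s≤s i<)) , m+[n+o]≡n+m+o i 2 b
  ... | inj₂ t∈D with i , i< , refl ← ∈-applyDownFrom⁻ (_+ (7 + 2 * q + b)) t∈D =
    7 + 2 * q + i , inj₂ (m≤m+n _ i , <-≤-trans (+-monoʳ-< (7 + 2 * q) i<) (≤-reflexive ([L+2]+[L-2]≡2L q))) ,
    m+[n+o]≡n+m+o i (7 + 2 * q) b
    where
      [L+2]+[L-2]≡2L : ∀ q → 7 + 2 * q + (3 + 2 * q) ≡ 10 + 4 * q
      [L+2]+[L-2]≡2L = solve-∀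

  ¬InC₁-small : ∀ {t} → t < 2 → ¬ InC₁ t
  ¬InC₁-small t<2 (inj₁ (2≤t , _)) = <⇒≱ t<2 2≤t
  ¬InC₁-small t<2 (inj₂ (L+2≤t , _)) = <⇒≱ t<2 (≤-trans (s≤s (s≤s z≤n)) L+2≤t)

  ¬InC₁-gap : ∀ {t} → 5 + 2 * q ≤ t → t < 7 + 2 * q → ¬ InC₁ t
  ¬InC₁-gap L≤t _ (inj₁ (_ , t<L)) = <⇒≱ t<L L≤t
  ¬InC₁-gap _ t<L+2 (inj₂ (L+2≤t , _)) = <⇒≱ t<L+2 L+2≤t

  ¬InC₁-large : ∀ {t} → 10 + 4 * q ≤ t → ¬ InC₁ t
  ¬InC₁-large 2L≤t t∈ = <⇒≱ (InC₁⇒<2L t∈) 2L≤t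

  -- Offsets in [2L, N + 1] reduce modulo N into [2L, N) ∪ {0, 1}, which avoids C₁.
  ¬InC₁-% : ∀ t → 10 + 4 * q ≤ t → t ≤ suc N → ¬ InC₁ (t % N)
  ¬InC₁-% t 2L≤t t≤1+N with t <? N
  ... | yes t<N = subst (λ r → ¬ InC₁ r) (sym (m<n⇒m%n≡m t<N)) (¬InC₁-large 2L≤t)
  ... | no t≮N = subst (λ r → ¬ InC₁ r) (sym t%N≡t∸N) (¬InC₁-small t∸N<2)
    where
      N≤t = ≮⇒≥ t≮N
      t∸N<2 : t ∸ N < 2
      t∸N<2 = s≤s (subst (t ∸ N ≤_) (m+n∸n≡m 1 N) (∸-monoˡ-≤ N t≤1+N))
      t%N≡t∸N : t % N ≡ t ∸ N
      t%N≡t∸N = trans (sym (m≤n⇒[n∸m]%m≡n%m N≤t)) (m<n⇒m%n≡m (<-≤-trans t∸N<2 (≤-trans (s≤s (s≤s z≤n)) 2L≤N)))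

  data Zone (d : ℕ) : Set where
    one    : d ≡ 1 → Zone d
    near   : 2 ≤ d → d ≤ 6 + 2 * q → Zone d
    middle : 7 + 2 * q ≤ d → d ≤ 7 + 4 * q → Zone d
    far    : 8 + 4 * q ≤ d → Zone d

  zone : ∀ d → 1 ≤ d → Zone d
  zone d 1≤d with d ≤? 1 | d ≤? 6 + 2 * q | d ≤? 7 + 4 * q
  ... | yes d≤1 | _        | _        = one (≤-antisym d≤1 1≤d)
  ... | no d≰1  | yes d≤L+1 | _       = near (≰⇒> d≰1) d≤L+1
  ... | no _    | no d≰L+1 | yes d≤2L-3 = middle (≰⇒> d≰L+1) d≤2L-3
  ... | no _    | no _     | no d≰2L-3 = far (≰⇒> d≰2L-3)

  module _ (3L+1≤N : 16 + 6 * q ≤ N) where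

    ≤3L+1⇒≤1+N : ∀ {t} → t ≤ 16 + 6 * q → t ≤ suc N
    ≤3L+1⇒≤1+N t≤3L+1 = ≤-trans t≤3L+1 (≤-trans 3L+1≤N (n≤1+n N))

    even-witness : ∀ d → 1 ≤ d → d < N → ∃ λ k → InC₁ k × Even k × ¬ InC₁ ((d + k) % N)
    even-witness d 1≤d d<N with zone d 1≤d
    ... | one refl = 4 + 2 * q , inj₁ (s≤s (s≤s z≤n) , ≤-refl) , even-*ˡ 2 q refl ,
                     subst (λ r → ¬ InC₁ r) (sym (m<n⇒m%n≡m L<N)) (¬InC₁-gap ≤-refl (≤-linear 6 2 7 2))
    ... | near 2≤d d≤L+1 = 8 + 4 * q , inj₂ (≤-linear 7 2 8 4 , ≤-linear 9 4 10 4) , even-*ˡ 4 q refl ,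
                           ¬InC₁-% _ (+-monoˡ-≤ (8 + 4 * q) 2≤d)
                                     (≤3L+1⇒≤1+N (≤-trans (+-monoˡ-≤ (8 + 4 * q) d≤L+1) (m+k≡n⇒m≤n 2 ([L+1]+[2L-2]+2≡3L+1 q))))
      where
        [L+1]+[2L-2]+2≡3L+1 : ∀ q → 6 + 2 * q + (8 + 4 * q) + 2 ≡ 16 + 6 * q
        [L+1]+[2L-2]+2≡3L+1 = solve-∀
    ... | middle L+2≤d d≤2L-3 = 4 + 2 * q , inj₁ (s≤s (s≤s z≤n) , ≤-refl) , even-*ˡ 2 q refl ,
                               ¬InC₁-% _ (≤-trans (m+k≡n⇒m≤n 1 (2L+1≡[L+2]+[L-1] q)) (+-monoˡ-≤ (4 + 2 * q) L+2≤d))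
                                         (≤3L+1⇒≤1+N (≤-trans (+-monoˡ-≤ (4 + 2 * q) d≤2L-3) (m+k≡n⇒m≤n 5 ([2L-3]+[L-1]+5≡3L+1 q))))
      where
        2L+1≡[L+2]+[L-1] : ∀ q → 10 + 4 * q + 1 ≡ 7 + 2 * q + (4 + 2 * q)
        2L+1≡[L+2]+[L-1] = solve-∀
        [2L-3]+[L-1]+5≡3L+1 : ∀ q → 7 + 4 * q + (4 + 2 * q) + 5 ≡ 16 + 6 * q
        [2L-3]+[L-1]+5≡3L+1 = solve-∀
    ... | far 2L-2≤d = 2 , inj₁ (≤-refl , s≤s (s≤s (s≤s z≤n))) , refl ,
                       ¬InC₁-% _ (subst (_≤ d + 2) ([2L-2]+2≡2L q) (+-monoˡ-≤ 2 2L-2≤d)) (subst (_≤ suc N) (+-comm 2 d) (s≤s d<N))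
      where
        [2L-2]+2≡2L : ∀ q → 8 + 4 * q + 2 ≡ 10 + 4 * q
        [2L-2]+2≡2L = solve-∀

    -- The mirror images 2L + 1 - k of the even witnesses, under the symmetry o ↦ 2L + 1 - o of
    -- C₁'s offsets; e = N - d is the distance from v back to u.
    odd-witness : ∀ d e → d + e ≡ N → 1 ≤ d → 1 ≤ e → ∃ λ k → InC₁ k × Odd k × ¬ InC₁ ((d + k) % N)
    odd-witness d e d+e≡N 1≤d 1≤e with zone e 1≤e
    ... | one refl = 7 + 2 * q , inj₂ (≤-refl , ≤-linear 8 2 10 4) , odd+even {1} {2 * q} refl (even-*ˡ 2 q refl) ,
                     subst (λ r → ¬ InC₁ r) (sym d+k≡L+1) (¬InC₁-gap (n≤1+n _) ≤-refl)
      where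
        d+[L+2]≡[L+1]+[d+1] : ∀ d q → d + (7 + 2 * q) ≡ 6 + 2 * q + (d + 1)
        d+[L+2]≡[L+1]+[d+1] = solve-∀
        d+k≡L+1 : (d + (7 + 2 * q)) % N ≡ 6 + 2 * q
        d+k≡L+1 = trans (cong (_% N) (trans (d+[L+2]≡[L+1]+[d+1] d q) (cong (6 + 2 * q +_) d+e≡N)))
                    (trans ([m+n]%n≡m%n (6 + 2 * q) N) (m<n⇒m%n≡m (≤-trans (≤-linear 7 2 10 4) 2L≤N)))
    ... | near 2≤e e≤L+1 = 3 , inj₁ (s≤s (s≤s z≤n) , s≤s (s≤s (s≤s (s≤s z≤n)))) , refl ,
                           ¬InC₁-% _ (≤-trans (≤-complement {10 + 4 * q} d+e≡N e≤L+1 (≤-trans (≤-reflexive (2L+[L+1]≡3L+1 q)) 3L+1≤N))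
                                               (m≤m+n d 3))
                                     (subst (_≤ suc N) (sym (+-suc d 2)) (s≤s (≤-trans (+-monoʳ-≤ d 2≤e) (≤-reflexive d+e≡N))))
      where
        2L+[L+1]≡3L+1 : ∀ q → 10 + 4 * q + (6 + 2 * q) ≡ 16 + 6 * q
        2L+[L+1]≡3L+1 = solve-∀
    ... | middle L+2≤e e≤2L-3 = 7 + 2 * q , inj₂ (≤-refl , ≤-linear 8 2 10 4) , odd+even {1} {2 * q} refl (even-*ˡ 2 q refl) ,
                               ¬InC₁-% _ (subst (_≤ d + (7 + 2 * q)) ([L-2]+[L+2]≡2L q)
                                           (+-monoˡ-≤ (7 + 2 * q) (≤-complement {3 + 2 * q} d+e≡N e≤2L-3
                                             (≤-trans (m+k≡n⇒m≤n 6 ([L-2]+[2L-3]+6≡3L+1 q)) 3L+1≤N))))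
                                         (≤-trans (+-monoʳ-≤ d L+2≤e) (≤-trans (≤-reflexive d+e≡N) (n≤1+n N)))
      where
        [L-2]+[L+2]≡2L : ∀ q → 3 + 2 * q + (7 + 2 * q) ≡ 10 + 4 * q
        [L-2]+[L+2]≡2L = solve-∀
        [L-2]+[2L-3]+6≡3L+1 : ∀ q → 3 + 2 * q + (7 + 4 * q) + 6 ≡ 16 + 6 * q
        [L-2]+[2L-3]+6≡3L+1 = solve-∀
    ... | far 2L-2≤e = 9 + 4 * q , inj₂ (≤-linear 7 2 9 4 , ≤-refl) , odd+even {1} {4 * q} refl (even-*ˡ 4 q refl) ,
                       ¬InC₁-% _ (+-monoˡ-≤ (9 + 4 * q) 1≤d)
                               (subst (_≤ suc N) (sym (+-suc d (8 + 4 * q))) (s≤s (≤-trans (+-monoʳ-≤ d 2L-2≤e) (≤-reflexive d+e≡N))))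

    witness : ∀ X d → 1 ≤ d → d < N → ∃ λ k → InC₁ k × Odd (k + X) × ¬ InC₁ ((d + k) % N)
    witness X d 1≤d d<N with even⊎odd X
    ... | inj₂ X-odd with k , k∈ , k-even , out ← even-witness d 1≤d d<N = k , k∈ , even+odd {k} {X} k-even X-odd , out
    ... | inj₁ X-even with k , k∈ , k-odd , out ← odd-witness d (N ∸ d) (m+[n∸m]≡n (<⇒≤ d<N)) 1≤d (m<n⇒0<n∸m d<N) =
      k , k∈ , odd+even {k} {X} k-odd X-even , out

  ∉C₁ : ∀ b {t} → ¬ InC₁ (t % N) → ¬ vtx (t + b) ∈ map vtx (C₁ b)
  ∉C₁ b {t} out t∈ with t′ , t′∈ , same ← ∈-map⁻ vtx t∈ with o , o∈ , refl ← ∈C₁⁻ b t′∈ =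
    out (subst InC₁ (sym t%N≡o) o∈)
    where
      t%N≡o : t % N ≡ o
      t%N≡o = trans (%-cancelʳ-+ b (vtx-≡⇒%-≡ same)) (m<n⇒m%n≡m (<-≤-trans (InC₁⇒<2L o∈) 2L≤N))

  separate : (∀ b → Odd b → ∃ λ C₂ → TwoCycleFactor G (map vtx (C₁ b)) C₂) →
              ∀ {u v} b {k t} → Odd b → InC₁ k → ¬ InC₁ (t % N) → vtx (k + b) ≡ u → vtx (t + b) ≡ v →
              ∃ λ C₁′ → ∃ λ C₂ → TwoCycleFactor G C₁′ C₂ × u ∈ C₁′ × v ∈ C₂
  separate factors {v = v} b b-odd k∈ out k+b≡u t+b≡v =
    map vtx (C₁ b) , C₂ , F , subst (_∈ map vtx (C₁ b)) k+b≡u (∈-map⁺ vtx (∈C₁⁺ b k∈)) ,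
    [ (λ v∈C₁ → ⊥-elim (∉C₁ b out (subst (_∈ map vtx (C₁ b)) (sym t+b≡v) v∈C₁))) , (λ v∈C₂ → v∈C₂) ]′ (cover v)
    where
      C₂ = proj₁ (factors b b-odd)
      F = proj₂ (factors b b-odd)
      cover = proj₁ (proj₂ (proj₂ F))

  offset-odd : ∀ X k → k ≤ X + N → Odd (k + X) → Odd (X + N ∸ k)
  offset-odd X k k≤X+N k+X-odd = begin
    b % 2              ≡⟨ [m+kn]%n≡m%n b k 2 ⟨
    (b + k * 2) % 2    ≡⟨ cong (_% 2) (trans (b+k*2≡[k+b]+k b k) (trans (cong (_+ k) (m+[n∸m]≡n k≤X+N)) ([X+N]+k≡[k+X]+N X N k))) ⟩
    (k + X + N) % 2    ≡⟨ %2-distrib-+ {k + X} {N} k+X-odd N-even ⟩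
    1                  ∎
    where
      open ≡-Reasoning
      b = X + N ∸ k
      b+k*2≡[k+b]+k : ∀ b k → b + k * 2 ≡ k + b + k
      b+k*2≡[k+b]+k = solve-∀
      [X+N]+k≡[k+X]+N : ∀ X N k → X + N + k ≡ k + X + N
      [X+N]+k≡[k+X]+N = solve-∀

  offset-vtx : ∀ X k d → k ≤ X + N → vtx (d + k + (X + N ∸ k)) ≡ vtx (d + X)
  offset-vtx X k d k≤X+N = trans (cong vtx (begin
    d + k + (X + N ∸ k)     ≡⟨ +-assoc d k _ ⟩
    d + (k + (X + N ∸ k))   ≡⟨ cong (d +_) (m+[n∸m]≡n k≤X+N) ⟩
    d + (X + N)             ≡⟨ +-assoc d X N ⟨
    d + X + N               ∎)) (vtx-+N (d + X))
    where open ≡-Reasoning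

  distance-pos : ∀ {x y : Fin N} d → x ≢ y → vtx (d + toℕ x) ≡ (Fin.zero , y) → 1 ≤ d
  distance-pos {x} zero    x≢y hit = ⊥-elim (x≢y (cong proj₂ (trans (sym (vtx-toℕ x)) hit)))
  distance-pos     (suc d) _   _   = s≤s z≤n

  twoSpanningCyclable : 16 + 6 * q ≤ N → (∀ b → Odd b → ∃ λ C₂ → TwoCycleFactor G (map vtx (C₁ b)) C₂) →
               TwoSpanningCyclable G
  twoSpanningCyclable 3L+1≤N factors (Fin.zero , x) (Fin.zero , y) u≢v
    with d , d<N , hit ← reach (toℕ x) y
    with k , k∈ , k+X-odd , out ← witness 3L+1≤N (toℕ x) d (distance-pos d (u≢v ∘ cong (Fin.zero ,_)) hit) d<N =
    let k≤X+N = ≤-trans (<⇒≤ (<-≤-trans (InC₁⇒<2L k∈) 2L≤N)) (m≤n+m N (toℕ x))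
    in separate factors (toℕ x + N ∸ k) (offset-odd (toℕ x) k k≤X+N k+X-odd) k∈ out
         (trans (offset-vtx (toℕ x) k 0 k≤X+N) (vtx-toℕ x)) (trans (offset-vtx (toℕ x) k d k≤X+N) hit)

odd>3⇒5+2q : ∀ ℓ → Odd ℓ → 3 < ℓ → ∃ λ q → ℓ ≡ 5 + 2 * q
odd>3⇒5+2q (suc (suc (suc (suc (suc r))))) ℓ-odd _ with even⊎odd r
... | inj₁ r-even = r / 2 , cong (5 +_) (begin
  r                  ≡⟨ m≡m%n+[m/n]*n r 2 ⟩
  r % 2 + r / 2 * 2  ≡⟨ cong (_+ r / 2 * 2) r-even ⟩
  r / 2 * 2          ≡⟨ *-comm (r / 2) 2 ⟩
  2 * (r / 2)        ∎)
  where open ≡-Reasoning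
... | inj₂ r-odd = ⊥-elim (0≢1+n (trans (sym (%2-distrib-+ {1} {r} refl r-odd)) ℓ-odd))
odd>3⇒5+2q 1 _ (s≤s ())
odd>3⇒5+2q 3 _ (s≤s (s≤s (s≤s ())))

positive-coefficient : ∀ β γ {a c} → 0 < β * a + γ * c → 0 < β + γ
positive-coefficient zero    zero    ()
positive-coefficient zero    (suc γ) _ = s≤s z≤n
positive-coefficient (suc β) γ       _ = s≤s z≤n

HTG₁-twoSpanningCyclable : ∀ q β γ N → 0 < β + γ →
  γ * (16 + 6 * q) + (β * (6 + 2 * q) + (10 + 4 * q)) ≡ N → TwoSpanningCyclable (HTG 1 N (5 + 2 * q))
HTG₁-twoSpanningCyclable q β γ N β+γ>0 size = twoSpanningCyclable 3L+1≤N (C₁-TwoCycleFactor β γ size)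
  where
    halve : ∀ q β γ → γ * (16 + 6 * q) + (β * (6 + 2 * q) + (10 + 4 * q)) ≡ 2 * (γ * (8 + 3 * q) + β * (3 + q) + (5 + 2 * q))
    halve = solve-∀
    N-even : Even N
    N-even = subst Even (trans (sym (halve q β γ)) size) (even-*ˡ 2 (γ * (8 + 3 * q) + β * (3 + q) + (5 + 2 * q)) refl)
    2L≤N : 10 + 4 * q ≤ N
    2L≤N = ≤-trans (m≤n+m (10 + 4 * q) (β * (6 + 2 * q))) (≤-trans (m≤n+m _ (γ * (16 + 6 * q))) (≤-reflexive size))
    instance
      N-nonZero : NonZero N
      N-nonZero = >-nonZero (≤-trans (s≤s z≤n) 2L≤N)
    open HTG₁ q N N-even 2L≤N
    3L+1≤N : 16 + 6 * q ≤ N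
    3L+1≤N = ≤-trans (3L+1≤ β γ β+γ>0) (≤-reflexive size)
      where
        [3L+1]+β[L+1]≡[1+β][L+1]+2L : ∀ q β → 16 + 6 * q + β * (6 + 2 * q) ≡ suc β * (6 + 2 * q) + (10 + 4 * q)
        [3L+1]+β[L+1]≡[1+β][L+1]+2L = solve-∀
        3L+1≤ : ∀ β γ → 0 < β + γ → 16 + 6 * q ≤ γ * (16 + 6 * q) + (β * (6 + 2 * q) + (10 + 4 * q))
        3L+1≤ zero    (suc γ) _ = ≤-trans (m≤m+n (16 + 6 * q) (γ * (16 + 6 * q))) (m≤m+n _ _)
        3L+1≤ (suc β) γ       _ = ≤-trans (m+k≡n⇒m≤n _ ([3L+1]+β[L+1]≡[1+β][L+1]+2L q β)) (m≤n+m _ (γ * (16 + 6 * q)))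

theorem2p5 : (ℓ α β γ : ℕ) → ℓ % 2 ≡ 1 → 3 < ℓ → 0 < α →
    α ≡ β * (ℓ + 1) + γ * (3 * ℓ + 1) →
    TwoSpanningCyclable (HTG 1 (2 * ℓ + α) ℓ)
theorem2p5 ℓ α β γ ℓ-odd 3<ℓ 0<α refl with q , refl ← odd>3⇒5+2q ℓ ℓ-odd 3<ℓ =
  HTG₁-twoSpanningCyclable q β γ _ (positive-coefficient β γ 0<α) (regroup q β γ)
  where
    regroup : ∀ q β γ → γ * (16 + 6 * q) + (β * (6 + 2 * q) + (10 + 4 * q)) ≡
                        2 * (5 + 2 * q) + (β * (5 + 2 * q + 1) + γ * (3 * (5 + 2 * q) + 1))
    regroup = solve-∀
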